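{- Let $n\ge2$ and let $x_1,\ldots,x_n,y_1,\ldots,y_n\in\mathbb{Q}$ satisfy $[x_1,\ldots,x_n]=^n_{n-1}[y_1,\ldots,y_n]$. Then the following are equivalent: (i) $\sum_{i=1}^nx_i=0$; (ii) $\sum_{i=1}^nx_i^{n+1}=\sum_{i=1}^ny_i^{n+1}$.
   Context: $[x_1,\ldots,x_n]=^n_{n-1}[y_1,\ldots,y_n]$ means that the multisets $\{x_1,\ldots,x_n\}$ and $\{y_1,\ldots,y_n\}$ have no element in common and $\sum_{i=1}^nx_i^k=\sum_{i=1}^ny_i^k$ for every $k=1,\ldots,n-1$. -}

module Defs where

open import Data.Nat using (ℕ; zero; suc; _≤_)
open import Data.Fin using (Fin; zero; suc)
open import Data.Rational using (ℚ; _+_; _*_; 0ℚ; 1ℚ)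
open import Relation.Binary.PropositionalEquality using (_≡_; _≢_)
open import Data.Product using (_×_)

infixr 8 _^_
_^_ : ℚ → ℕ → ℚ
q ^ zero  = 1ℚ
q ^ suc k = q * (q ^ k)

sumℚ : ∀ {n} → (Fin n → ℚ) → ℚ
sumℚ {zero}  f = 0ℚ
sumℚ {suc n} f = f zero + sumℚ (λ i → f (suc i))

powerSum : ∀ {n} → (Fin n → ℚ) → ℕ → ℚ
powerSum x k = sumℚ (λ i → x i ^ k)

-- [x_1..x_n] =^n_{n-1} [y_1..y_n]: the multisets share no element, and
-- the power sums agree for k = 1, …, n-1  (stated as 1 ≤ k, suc k ≤ n).
PTE : ∀ n → (Fin n → ℚ) → (Fin n → ℚ) → Set
PTE n x y =
  (∀ i j → x i ≢ y j) ×
  (∀ k → 1 ≤ k → suc k ≤ n → powerSum x k ≡ powerSum y k)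

-- Let c = coeffs x be the signed elementary symmetric functions of x and p its power sums.
-- Newton's identities (c ⋆ p) k = -k c_k recover c_1, …, c_{n-1} from p_1, …, p_{n-1}, so x
-- and y share them. They cannot share c_n too, for then ∏ (t - x i) = ∏ (t - y j) and the two
-- multisets would meet; so d = c_n(x) - c_n(y) ≠ 0. Newton's identity at k = n gives
-- p_n(x) - p_n(y) = -n d, and at k = n + 1, using c_1 = -p_1 and c_{n+1} = 0, it gives
-- p_{n+1}(x) - p_{n+1}(y) = -(n + 1) d p_1. Hence the (n+1)-st power sums agree iff p_1 = 0.

module Submission where

open import Defs
open import Data.Nat using (ℕ; zero; suc; _≤_; _<_; z≤n; s≤s)
import Data.Nat.Properties as ℕ
open import Data.Fin using (Fin; zero; suc; fromℕ<)
open import Data.Rational as ℚ using (ℚ; 0ℚ; 1ℚ; _+_; _*_; _-_; -_; 1/_; +-0-rawMonoid)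
open import Data.Rational.Properties
  using ( +-*-commutativeRing; +-0-group; _≟_; +-identityˡ; +-identityʳ; +-inverseʳ; neg-injective
        ; *-identityˡ; *-identityʳ; *-zeroˡ; *-zeroʳ; *-assoc; *-inverseˡ; *-distribˡ-+
        ; <-irrefl; ≤-refl; <⇒≤; +-mono-<-≤; +-mono-≤; positive⁻¹)
open import Algebra.Definitions.RawMonoid +-0-rawMonoid using (_×_)
open import Algebra.Properties.Group +-0-group
  using (x∙y⁻¹≈ε⇒x≈y; x≈y⇒x∙y⁻¹≈ε; inverseˡ-unique)
open import Tactic.RingSolver using (solve-∀)
open import Tactic.RingSolver.Core.AlmostCommutativeRing using (AlmostCommutativeRing; fromCommutativeRing)
open import Data.Product using (_,_; ∃-syntax)
open import Data.Sum using (_⊎_; inj₁; inj₂)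
open import Function using (_∘_; _⇔_; mk⇔)
open import Level using (0ℓ)
open import Relation.Nullary using (yes; no)
open import Relation.Binary using (tri<; tri≈; tri>)
open import Relation.Nullary.Decidable.Core using (dec⇒maybe)
open import Relation.Binary.PropositionalEquality
  using (_≡_; _≢_; _≗_; refl; sym; trans; cong; cong₂; module ≡-Reasoning)

ring : AlmostCommutativeRing 0ℓ 0ℓ
ring = fromCommutativeRing +-*-commutativeRing (λ q → dec⇒maybe (0ℚ ≟ q))

p*q≡0⇒q≡0 : ∀ p q → p ≢ 0ℚ → p * q ≡ 0ℚ → q ≡ 0ℚ
p*q≡0⇒q≡0 p q p≢0 pq≡0 = begin
  q                ≡⟨ sym (*-identityˡ q) ⟩
  1ℚ * q           ≡⟨ cong (_* q) (sym (*-inverseˡ p)) ⟩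
  (1/ p) * p * q   ≡⟨ *-assoc (1/ p) p q ⟩
  (1/ p) * (p * q) ≡⟨ cong ((1/ p) *_) pq≡0 ⟩
  (1/ p) * 0ℚ      ≡⟨ *-zeroʳ (1/ p) ⟩
  0ℚ               ∎
  where
  open ≡-Reasoning
  instance _ = ℚ.≢-nonZero p≢0

p*q≡0⇒p≡0∨q≡0 : ∀ p q → p * q ≡ 0ℚ → p ≡ 0ℚ ⊎ q ≡ 0ℚ
p*q≡0⇒p≡0∨q≡0 p q pq≡0 with p ≟ 0ℚ
... | yes p≡0 = inj₁ p≡0
... | no p≢0  = inj₂ (p*q≡0⇒q≡0 p q p≢0 pq≡0)

p≢0∧q≢0⇒p*q≢0 : ∀ {p q} → p ≢ 0ℚ → q ≢ 0ℚ → p * q ≢ 0ℚ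
p≢0∧q≢0⇒p*q≢0 {p} {q} p≢0 q≢0 pq≡0 with p*q≡0⇒p≡0∨q≡0 p q pq≡0
... | inj₁ p≡0 = p≢0 p≡0
... | inj₂ q≡0 = q≢0 q≡0

×1-nonNeg : ∀ k → 0ℚ ℚ.≤ k × 1ℚ
×1-nonNeg zero    = ≤-refl
×1-nonNeg (suc k) = +-mono-≤ (<⇒≤ (positive⁻¹ 1ℚ)) (×1-nonNeg k)

suc×1≢0 : ∀ k → suc k × 1ℚ ≢ 0ℚ
suc×1≢0 k eq = <-irrefl (sym eq) (+-mono-<-≤ (positive⁻¹ 1ℚ) (×1-nonNeg k))

Seq : Set
Seq = ℕ → ℚ

-- (f ⋆ g) k = Σ_{i + j = k} f i * g j
_⋆_ : Seq → Seq → Seq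
(f ⋆ g) zero    = f 0 * g 0
(f ⋆ g) (suc k) = f 0 * g (suc k) + ((f ∘ suc) ⋆ g) k

shift : Seq → Seq
shift f zero    = 0ℚ
shift f (suc j) = f j

⋆-congˡ : ∀ {f f′} g → f ≗ f′ → f ⋆ g ≗ f′ ⋆ g
⋆-congˡ g f≗f′ zero    = cong (_* g 0) (f≗f′ 0)
⋆-congˡ g f≗f′ (suc k) = cong₂ _+_ (cong (_* g (suc k)) (f≗f′ 0)) (⋆-congˡ g (f≗f′ ∘ suc) k)

⋆-distribʳ-- : ∀ f h g k → ((λ j → f j - h j) ⋆ g) k ≡ (f ⋆ g) k - (h ⋆ g) k
⋆-distribʳ-- f h g zero    = *-distribʳ-- (f 0) (h 0) (g 0)
  where
  *-distribʳ-- : ∀ a b c → (a - b) * c ≡ a * c - b * c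
  *-distribʳ-- = solve-∀ ring
⋆-distribʳ-- f h g (suc k) =
  trans (cong ((f 0 - h 0) * g (suc k) +_) (⋆-distribʳ-- (f ∘ suc) (h ∘ suc) g k))
        (rearrange (f 0) (h 0) (g (suc k)) (((f ∘ suc) ⋆ g) k) (((h ∘ suc) ⋆ g) k))
  where
  rearrange : ∀ a b c u v → (a - b) * c + (u - v) ≡ (a * c + u) - (b * c + v)
  rearrange = solve-∀ ring

⋆-distribˡ-+ : ∀ f g h k → (f ⋆ (λ j → g j + h j)) k ≡ (f ⋆ g) k + (f ⋆ h) k
⋆-distribˡ-+ f g h zero    = *-distribˡ-+ (f 0) (g 0) (h 0)
⋆-distribˡ-+ f g h (suc k) =
  trans (cong (f 0 * (g (suc k) + h (suc k)) +_) (⋆-distribˡ-+ (f ∘ suc) g h k))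
        (rearrange (f 0) (g (suc k)) (h (suc k)) (((f ∘ suc) ⋆ g) k) (((f ∘ suc) ⋆ h) k))
  where
  rearrange : ∀ a b c u v → a * (b + c) + (u + v) ≡ (a * b + u) + (a * c + v)
  rearrange = solve-∀ ring

⋆-distribˡ-- : ∀ f g h k → (f ⋆ (λ j → g j - h j)) k ≡ (f ⋆ g) k - (f ⋆ h) k
⋆-distribˡ-- f g h zero    = *-distribˡ-- (f 0) (g 0) (h 0)
  where
  *-distribˡ-- : ∀ a b c → a * (b - c) ≡ a * b - a * c
  *-distribˡ-- = solve-∀ ring
⋆-distribˡ-- f g h (suc k) =
  trans (cong (f 0 * (g (suc k) - h (suc k)) +_) (⋆-distribˡ-- (f ∘ suc) g h k))
        (rearrange (f 0) (g (suc k)) (h (suc k)) (((f ∘ suc) ⋆ g) k) (((f ∘ suc) ⋆ h) k))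
  where
  rearrange : ∀ a b c u v → a * (b - c) + (u - v) ≡ (a * b + u) - (a * c + v)
  rearrange = solve-∀ ring

⋆-scaleˡ : ∀ a f g k → ((λ j → a * f j) ⋆ g) k ≡ a * (f ⋆ g) k
⋆-scaleˡ a f g zero    = *-assoc a (f 0) (g 0)
⋆-scaleˡ a f g (suc k) =
  trans (cong (a * f 0 * g (suc k) +_) (⋆-scaleˡ a (f ∘ suc) g k))
        (rearrange a (f 0) (g (suc k)) (((f ∘ suc) ⋆ g) k))
  where
  rearrange : ∀ a b c u → a * b * c + a * u ≡ a * (b * c + u)
  rearrange = solve-∀ ring

⋆-sucˡ : ∀ f g k → f 0 ≡ 0ℚ → (f ⋆ g) (suc k) ≡ ((f ∘ suc) ⋆ g) k
⋆-sucˡ f g k f0≡0 =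
  trans (cong (_+ ((f ∘ suc) ⋆ g) k) (trans (cong (_* g (suc k)) f0≡0) (*-zeroˡ (g (suc k)))))
        (+-identityˡ (((f ∘ suc) ⋆ g) k))

⋆-vanishʳ : ∀ f g k → (∀ j → j ≤ k → g j ≡ 0ℚ) → (f ⋆ g) k ≡ 0ℚ
⋆-vanishʳ f g zero    g≡0 = trans (cong (f 0 *_) (g≡0 0 z≤n)) (*-zeroʳ (f 0))
⋆-vanishʳ f g (suc k) g≡0 =
  cong₂ _+_ (trans (cong (f 0 *_) (g≡0 (suc k) ℕ.≤-refl)) (*-zeroʳ (f 0)))
            (⋆-vanishʳ (f ∘ suc) g k (λ j j≤k → g≡0 j (ℕ.m≤n⇒m≤1+n j≤k)))

⋆-leadingˡ : ∀ f g k → (∀ j → j < k → f j ≡ 0ℚ) → (f ⋆ g) k ≡ f k * g 0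
⋆-leadingˡ f g zero    f≡0 = refl
⋆-leadingˡ f g (suc k) f≡0 =
  trans (⋆-sucˡ f g k (f≡0 0 (s≤s z≤n)))
        (⋆-leadingˡ (f ∘ suc) g k (λ j j<k → f≡0 (suc j) (s≤s j<k)))

⋆-subleadingˡ : ∀ f g k → (∀ j → j < k → f j ≡ 0ℚ) → (f ⋆ g) (suc k) ≡ f k * g 1 + f (suc k) * g 0
⋆-subleadingˡ f g zero    f≡0 = refl
⋆-subleadingˡ f g (suc k) f≡0 =
  trans (⋆-sucˡ f g (suc k) (f≡0 0 (s≤s z≤n)))
        (⋆-subleadingˡ (f ∘ suc) g k (λ j j<k → f≡0 (suc j) (s≤s j<k)))

⋆-leadingʳ : ∀ f g k → (∀ j → j < k → g j ≡ 0ℚ) → (f ⋆ g) k ≡ f 0 * g k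
⋆-leadingʳ f g zero    g≡0 = refl
⋆-leadingʳ f g (suc k) g≡0 =
  trans (cong (f 0 * g (suc k) +_) (⋆-vanishʳ (f ∘ suc) g k (λ j j≤k → g≡0 j (s≤s j≤k))))
        (+-identityʳ (f 0 * g (suc k)))

⋆-subleadingʳ : ∀ f g k → (∀ j → j < k → g j ≡ 0ℚ) → (f ⋆ g) (suc k) ≡ f 0 * g (suc k) + f 1 * g k
⋆-subleadingʳ f g k g≡0 = cong (f 0 * g (suc k) +_) (⋆-leadingʳ (f ∘ suc) g k g≡0)

-- coeffs x j is the coefficient of t ^ (n - j) in ∏ᵢ (t - x i), that is (-1) ^ j e_j(x).
coeffs : ∀ {n} → (Fin n → ℚ) → Seq
coeffs x zero = 1ℚ
coeffs {zero}  x (suc k) = 0ℚ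
coeffs {suc n} x (suc k) = coeffs (x ∘ suc) (suc k) - x zero * coeffs (x ∘ suc) k

-- The constant term is 0 rather than 1, so that Newton's identity below holds uniformly in k.
powers₊ : ℚ → Seq
powers₊ a zero    = 0ℚ
powers₊ a (suc k) = a ^ suc k

powerSums : ∀ {n} → (Fin n → ℚ) → Seq
powerSums x k = sumℚ (λ i → powers₊ (x i) k)

powerSums-zero : ∀ {n} (x : Fin n → ℚ) → powerSums x 0 ≡ 0ℚ
powerSums-zero {zero}  x = refl
powerSums-zero {suc n} x = trans (+-identityˡ (powerSums (x ∘ suc) 0)) (powerSums-zero (x ∘ suc))

coeffs-cons : ∀ {n} (x : Fin (suc n) → ℚ) →
  coeffs x ≗ (λ j → coeffs (x ∘ suc) j - x zero * shift (coeffs (x ∘ suc)) j)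
coeffs-cons x zero    = sym (cong (_-_ 1ℚ) (*-zeroʳ (x zero)))
coeffs-cons x (suc k) = refl

coeffs-degree : ∀ {n} (x : Fin n → ℚ) k → n < k → coeffs x k ≡ 0ℚ
coeffs-degree {zero}  x (suc k) _          = refl
coeffs-degree {suc n} x (suc k) (s≤s n<k) =
  trans (cong₂ (λ u v → u - x zero * v) (coeffs-degree (x ∘ suc) (suc k) (ℕ.m<n⇒m<1+n n<k))
                                         (coeffs-degree (x ∘ suc) k n<k))
        (cong (_-_ 0ℚ) (*-zeroʳ (x zero)))

powerSums-1 : ∀ {n} (x : Fin n → ℚ) → powerSums x 1 ≡ sumℚ x
powerSums-1 {zero}  x = refl
powerSums-1 {suc n} x = cong₂ _+_ (*-identityʳ (x zero)) (powerSums-1 (x ∘ suc))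

coeffs-1 : ∀ {n} (x : Fin n → ℚ) → coeffs x 1 ≡ - sumℚ x
coeffs-1 {zero}  x = refl
coeffs-1 {suc n} x =
  trans (cong (_- x zero * 1ℚ) (coeffs-1 (x ∘ suc))) (rearrange (x zero) (sumℚ (x ∘ suc)))
  where
  rearrange : ∀ a s → - s - a * 1ℚ ≡ - (a + s)
  rearrange = solve-∀ ring

⋆-powers₊ : ∀ f a k → (f ⋆ powers₊ a) (suc k) ≡ a * f k + a * (f ⋆ powers₊ a) k
⋆-powers₊ f a zero    = rearrange a (f 0) (f 1)
  where
  rearrange : ∀ a b c → b * (a * 1ℚ) + c * 0ℚ ≡ a * b + a * (b * 0ℚ)
  rearrange = solve-∀ ring
⋆-powers₊ f a (suc k) =
  trans (cong (f 0 * (a * a ^ suc k) +_) (⋆-powers₊ (f ∘ suc) a k))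
        (rearrange a (f 0) (a ^ suc k) (f (suc k)) (((f ∘ suc) ⋆ powers₊ a) k))
  where
  rearrange : ∀ a b p c u → b * (a * p) + (a * c + a * u) ≡ a * c + a * (b * p + u)
  rearrange = solve-∀ ring

newton : ∀ {n} (x : Fin n → ℚ) k → (coeffs x ⋆ powerSums x) k ≡ - ((k × 1ℚ) * coeffs x k)
newton x zero = trans (*-identityˡ (powerSums x 0)) (powerSums-zero x)
newton {zero} x (suc k) =
  trans (⋆-vanishʳ (coeffs x) (powerSums x) (suc k) (λ _ _ → refl))
        (sym (cong -_ (*-zeroʳ (suc k × 1ℚ))))
newton {suc n} x (suc k) = begin
  (coeffs x ⋆ p) (suc k)
    ≡⟨ ⋆-congˡ p (coeffs-cons x) (suc k) ⟩
  ((λ j → c j - a * shift c j) ⋆ p) (suc k)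
    ≡⟨ ⋆-distribʳ-- c (λ j → a * shift c j) p (suc k) ⟩
  (c ⋆ p) (suc k) - ((λ j → a * shift c j) ⋆ p) (suc k)
    ≡⟨ cong (_-_ ((c ⋆ p) (suc k))) (trans (⋆-scaleˡ a (shift c) p (suc k))
                                               (cong (a *_) (⋆-sucˡ (shift c) p k refl))) ⟩
  (c ⋆ p) (suc k) - a * (c ⋆ p) k
    ≡⟨ cong₂ (λ u v → u - a * v) (⋆-distribˡ-+ c (powers₊ a) p′ (suc k))
                                 (⋆-distribˡ-+ c (powers₊ a) p′ k) ⟩
  ((c ⋆ powers₊ a) (suc k) + (c ⋆ p′) (suc k)) - a * ((c ⋆ powers₊ a) k + (c ⋆ p′) k)
    ≡⟨ cong₂ (λ u v → u - a * ((c ⋆ powers₊ a) k + v))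
             (cong₂ _+_ (⋆-powers₊ c a k) (newton (x ∘ suc) (suc k))) (newton (x ∘ suc) k) ⟩
  (a * c k + a * (c ⋆ powers₊ a) k + - ((suc k × 1ℚ) * c (suc k)))
    - a * ((c ⋆ powers₊ a) k + - ((k × 1ℚ) * c k))
    ≡⟨ rearrange a (c k) (c (suc k)) ((c ⋆ powers₊ a) k) (k × 1ℚ) ⟩
  - ((suc k × 1ℚ) * coeffs x (suc k))
    ∎
  where
  open ≡-Reasoning
  a  = x zero
  c  = coeffs (x ∘ suc)
  p  = powerSums x
  p′ = powerSums (x ∘ suc)
  rearrange : ∀ a c c′ u m →
    (a * c + a * u + - ((1ℚ + m) * c′)) - a * (u + - (m * c)) ≡ - ((1ℚ + m) * (c′ - a * c))
  rearrange = solve-∀ ring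

horner : Seq → ℚ → ℕ → ℚ
horner c t zero    = c 0
horner c t (suc m) = t * horner c t m + c (suc m)

horner-cong : ∀ {c c′} t → c ≗ c′ → ∀ m → horner c t m ≡ horner c′ t m
horner-cong t c≗c′ zero    = c≗c′ 0
horner-cong t c≗c′ (suc m) = cong₂ (λ u v → t * u + v) (horner-cong t c≗c′ m) (c≗c′ (suc m))

horner-coeffs-cons : ∀ {n} (x : Fin (suc n) → ℚ) t m →
  horner (coeffs x) t (suc m) ≡ horner (coeffs (x ∘ suc)) t (suc m) - x zero * horner (coeffs (x ∘ suc)) t m
horner-coeffs-cons x t zero    = rearrange t (x zero) (coeffs (x ∘ suc) 1)
  where
  rearrange : ∀ t a c → t * 1ℚ + (c - a * 1ℚ) ≡ (t * 1ℚ + c) - a * 1ℚ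
  rearrange = solve-∀ ring
horner-coeffs-cons x t (suc m) =
  trans (cong (λ u → t * u + coeffs x (suc (suc m))) (horner-coeffs-cons x t m))
        (rearrange t (x zero) (horner c t (suc m)) (horner c t m) (c (suc (suc m))) (c (suc m)))
  where
  c = coeffs (x ∘ suc)
  rearrange : ∀ t a h₁ h₀ c₁ c₀ →
    t * (h₁ - a * h₀) + (c₁ - a * c₀) ≡ (t * h₁ + c₁) - a * (t * h₀ + c₀)
  rearrange = solve-∀ ring

rootPoly : ∀ {n} → (Fin n → ℚ) → ℚ → ℚ
rootPoly {zero}  x t = 1ℚ
rootPoly {suc n} x t = (t - x zero) * rootPoly (x ∘ suc) t

rootPoly-horner : ∀ {n} (x : Fin n → ℚ) t → rootPoly x t ≡ horner (coeffs x) t n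
rootPoly-horner {zero}  x t = refl
rootPoly-horner {suc n} x t = begin
  (t - a) * rootPoly (x ∘ suc) t  ≡⟨ cong ((t - a) *_) (rootPoly-horner (x ∘ suc) t) ⟩
  (t - a) * h                     ≡⟨ rearrange t a h ⟩
  (t * h + 0ℚ) - a * h            ≡⟨ cong (λ z → (t * h + z) - a * h)
                                          (sym (coeffs-degree (x ∘ suc) (suc n) ℕ.≤-refl)) ⟩
  horner c t (suc n) - a * h      ≡⟨ sym (horner-coeffs-cons x t n) ⟩
  horner (coeffs x) t (suc n)     ∎
  where
  open ≡-Reasoning
  a = x zero
  c = coeffs (x ∘ suc)
  h = horner c t n
  rearrange : ∀ t a h → (t - a) * h ≡ (t * h + 0ℚ) - a * h
  rearrange = solve-∀ ring

rootPoly-root : ∀ {n} (x : Fin n → ℚ) i → rootPoly x (x i) ≡ 0ℚ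
rootPoly-root x zero    = trans (cong (_* rootPoly (x ∘ suc) (x zero)) (+-inverseʳ (x zero)))
                                (*-zeroˡ (rootPoly (x ∘ suc) (x zero)))
rootPoly-root x (suc i) = trans (cong ((x (suc i) - x zero) *_) (rootPoly-root (x ∘ suc) i))
                                (*-zeroʳ (x (suc i) - x zero))

rootPoly≡0⇒root : ∀ {n} (x : Fin n → ℚ) t → rootPoly x t ≡ 0ℚ → ∃[ i ] t ≡ x i
rootPoly≡0⇒root {zero}  x t ()
rootPoly≡0⇒root {suc n} x t r≡0 with p*q≡0⇒p≡0∨q≡0 (t - x zero) (rootPoly (x ∘ suc) t) r≡0
... | inj₁ t-a≡0 = zero , x∙y⁻¹≈ε⇒x≈y t (x zero) t-a≡0
... | inj₂ r′≡0 with rootPoly≡0⇒root (x ∘ suc) t r′≡0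
...   | i , t≡xi = suc i , t≡xi

coeffs≗⇒roots⊆ : ∀ {n} (x y : Fin n → ℚ) → coeffs x ≗ coeffs y → ∀ i → ∃[ j ] x i ≡ y j
coeffs≗⇒roots⊆ {n} x y cx≗cy i = rootPoly≡0⇒root y (x i) (begin
  rootPoly y (x i)            ≡⟨ rootPoly-horner y (x i) ⟩
  horner (coeffs y) (x i) n   ≡⟨ sym (horner-cong (x i) cx≗cy n) ⟩
  horner (coeffs x) (x i) n   ≡⟨ sym (rootPoly-horner x (x i)) ⟩
  rootPoly x (x i)            ≡⟨ rootPoly-root x i ⟩
  0ℚ                          ∎)
  where open ≡-Reasoning

module _ {n} (x y : Fin n → ℚ) where

  Δc : Seq
  Δc j = coeffs x j - coeffs y j

  Δp : Seq
  Δp j = powerSums x j - powerSums y j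

  newton-Δ : ∀ k → (coeffs x ⋆ Δp) k + (Δc ⋆ powerSums y) k ≡ - ((k × 1ℚ) * Δc k)
  newton-Δ k = begin
    (cx ⋆ Δp) k + (Δc ⋆ py) k
      ≡⟨ cong₂ _+_ (⋆-distribˡ-- cx px py k) (⋆-distribʳ-- cx cy py k) ⟩
    ((cx ⋆ px) k - (cx ⋆ py) k) + ((cx ⋆ py) k - (cy ⋆ py) k)
      ≡⟨ telescope ((cx ⋆ px) k) ((cx ⋆ py) k) ((cy ⋆ py) k) ⟩
    (cx ⋆ px) k - (cy ⋆ py) k
      ≡⟨ cong₂ _-_ (newton x k) (newton y k) ⟩
    - ((k × 1ℚ) * cx k) - - ((k × 1ℚ) * cy k)
      ≡⟨ rearrange (k × 1ℚ) (cx k) (cy k) ⟩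
    - ((k × 1ℚ) * Δc k) ∎
    where
    open ≡-Reasoning
    cx = coeffs x
    cy = coeffs y
    px = powerSums x
    py = powerSums y
    telescope : ∀ u v w → (u - v) + (v - w) ≡ u - w
    telescope = solve-∀ ring
    rearrange : ∀ m a b → - (m * a) - - (m * b) ≡ - (m * (a - b))
    rearrange = solve-∀ ring

  Δc⋆p≡0 : ∀ m → (∀ j → j < m → Δc j ≡ 0ℚ) → (Δc ⋆ powerSums y) m ≡ 0ℚ
  Δc⋆p≡0 m Δc≡0 = begin
    (Δc ⋆ powerSums y) m   ≡⟨ ⋆-leadingˡ Δc (powerSums y) m Δc≡0 ⟩
    Δc m * powerSums y 0   ≡⟨ cong (Δc m *_) (powerSums-zero y) ⟩
    Δc m * 0ℚ              ≡⟨ *-zeroʳ (Δc m) ⟩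
    0ℚ                     ∎
    where open ≡-Reasoning

  Δc-next≡0 : ∀ m → (∀ j → j ≤ m → Δp j ≡ 0ℚ) → (∀ j → j < m → Δc j ≡ 0ℚ) → Δc m ≡ 0ℚ
  Δc-next≡0 zero    _    _    = refl
  Δc-next≡0 (suc m) Δp≡0 Δc≡0 =
    p*q≡0⇒q≡0 (suc m × 1ℚ) (Δc (suc m)) (suc×1≢0 m) (neg-injective (begin
      - ((suc m × 1ℚ) * Δc (suc m))                         ≡⟨ sym (newton-Δ (suc m)) ⟩
      (coeffs x ⋆ Δp) (suc m) + (Δc ⋆ powerSums y) (suc m)
        ≡⟨ cong₂ _+_ (⋆-vanishʳ (coeffs x) Δp (suc m) Δp≡0) (Δc⋆p≡0 (suc m) Δc≡0) ⟩
      0ℚ                                                    ∎))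
    where open ≡-Reasoning

  Δc-below≡0 : ∀ m → (∀ j → j < m → Δp j ≡ 0ℚ) → ∀ j → j < m → Δc j ≡ 0ℚ
  Δc-below≡0 (suc m) Δp≡0 j j<1+m with ℕ.m<1+n⇒m<n∨m≡n j<1+m
  ... | inj₁ j<m  = Δc-below≡0 m (λ i i<m → Δp≡0 i (ℕ.m<n⇒m<1+n i<m)) j j<m
  ... | inj₂ refl = Δc-next≡0 j (λ i i≤j → Δp≡0 i (s≤s i≤j))
                                (Δc-below≡0 j (λ i i<j → Δp≡0 i (ℕ.m<n⇒m<1+n i<j)))

  module _ (Δp≡0 : ∀ j → j < n → Δp j ≡ 0ℚ) where

    private
      Δc≡0 : ∀ j → j < n → Δc j ≡ 0ℚ
      Δc≡0 = Δc-below≡0 n Δp≡0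

      Δc-degree : Δc (suc n) ≡ 0ℚ
      Δc-degree = cong₂ _-_ (coeffs-degree x (suc n) ℕ.≤-refl) (coeffs-degree y (suc n) ℕ.≤-refl)

    Δp-top : Δp n ≡ - ((n × 1ℚ) * Δc n)
    Δp-top = begin
      Δp n                                       ≡⟨ rearrange (Δp n) ⟩
      1ℚ * Δp n + 0ℚ                             ≡⟨ cong₂ _+_ (sym (⋆-leadingʳ (coeffs x) Δp n Δp≡0))
                                                              (sym (Δc⋆p≡0 n Δc≡0)) ⟩
      (coeffs x ⋆ Δp) n + (Δc ⋆ powerSums y) n   ≡⟨ newton-Δ n ⟩
      - ((n × 1ℚ) * Δc n)                        ∎
      where
      open ≡-Reasoning
      rearrange : ∀ u → u ≡ 1ℚ * u + 0ℚ
      rearrange = solve-∀ ring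

    Δp-suc-top : 1 < n → Δp (suc n) ≡ - ((suc n × 1ℚ) * Δc n * sumℚ x)
    Δp-suc-top 1<n = inverseˡ-unique (Δp (suc n)) ((suc n × 1ℚ) * Δc n * sumℚ x) (begin
      Δp (suc n) + (suc n × 1ℚ) * Δc n * sumℚ x
        ≡⟨ rearrange (Δp (suc n)) (sumℚ x) (n × 1ℚ) (Δc n) ⟩
      (1ℚ * Δp (suc n) + (- sumℚ x) * (- ((n × 1ℚ) * Δc n))) + (Δc n * sumℚ x + 0ℚ * 0ℚ)
        ≡⟨ sym (cong₂ _+_ (cong₂ (λ u v → 1ℚ * Δp (suc n) + u * v) (coeffs-1 x) Δp-top)
                          (cong₂ (λ u v → Δc n * u + v) py₁≡Σx
                                 (cong₂ _*_ Δc-degree (powerSums-zero y)))) ⟩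
      (1ℚ * Δp (suc n) + coeffs x 1 * Δp n) + (Δc n * powerSums y 1 + Δc (suc n) * powerSums y 0)
        ≡⟨ sym (cong₂ _+_ (⋆-subleadingʳ (coeffs x) Δp n Δp≡0)
                          (⋆-subleadingˡ Δc (powerSums y) n Δc≡0)) ⟩
      (coeffs x ⋆ Δp) (suc n) + (Δc ⋆ powerSums y) (suc n)
        ≡⟨ newton-Δ (suc n) ⟩
      - ((suc n × 1ℚ) * Δc (suc n))
        ≡⟨ cong (λ z → - ((suc n × 1ℚ) * z)) Δc-degree ⟩
      - ((suc n × 1ℚ) * 0ℚ)
        ≡⟨ cong -_ (*-zeroʳ (suc n × 1ℚ)) ⟩
      0ℚ ∎)
      where
      open ≡-Reasoning
      py₁≡Σx : powerSums y 1 ≡ sumℚ x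
      py₁≡Σx = trans (sym (x∙y⁻¹≈ε⇒x≈y (powerSums x 1) (powerSums y 1) (Δp≡0 1 1<n)))
                     (powerSums-1 x)
      rearrange : ∀ d s m c →
        d + (1ℚ + m) * c * s ≡ (1ℚ * d + (- s) * (- (m * c))) + (c * s + 0ℚ * 0ℚ)
      rearrange = solve-∀ ring

    coeffs-≗ : Δc n ≡ 0ℚ → coeffs x ≗ coeffs y
    coeffs-≗ Δcn≡0 k with ℕ.<-cmp k n
    ... | tri< k<n _ _  = x∙y⁻¹≈ε⇒x≈y (coeffs x k) (coeffs y k) (Δc≡0 k k<n)
    ... | tri≈ _ refl _ = x∙y⁻¹≈ε⇒x≈y (coeffs x k) (coeffs y k) Δcn≡0
    ... | tri> _ _ n<k  = trans (coeffs-degree x k n<k) (sym (coeffs-degree y k n<k))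

    Δc-top≢0 : (∀ i j → x i ≢ y j) → Fin n → Δc n ≢ 0ℚ
    Δc-top≢0 disjoint i Δcn≡0 with coeffs≗⇒roots⊆ x y (coeffs-≗ Δcn≡0) i
    ... | j , xi≡yj = disjoint i j xi≡yj

theorem6p1 : (n : ℕ) → 2 ≤ n → (x y : Fin n → ℚ) → PTE n x y →
    (sumℚ x ≡ 0ℚ) ⇔ (powerSum x (suc n) ≡ powerSum y (suc n))
theorem6p1 n 2≤n x y (disjoint , equal) = mk⇔ sufficient necessary
  where
  Δp≡0 : ∀ j → j < n → Δp x y j ≡ 0ℚ
  Δp≡0 zero    _   = cong₂ _-_ (powerSums-zero x) (powerSums-zero y)
  Δp≡0 (suc j) j<n = x≈y⇒x∙y⁻¹≈ε (equal (suc j) (s≤s z≤n) j<n)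

  scale : ℚ
  scale = (suc n × 1ℚ) * Δc x y n

  gap : powerSum x (suc n) - powerSum y (suc n) ≡ - (scale * sumℚ x)
  gap = Δp-suc-top x y Δp≡0 2≤n

  scale≢0 : scale ≢ 0ℚ
  scale≢0 = p≢0∧q≢0⇒p*q≢0 (suc×1≢0 n)
                          (Δc-top≢0 x y Δp≡0 disjoint (fromℕ< (ℕ.≤-trans (s≤s z≤n) 2≤n)))

  sufficient : sumℚ x ≡ 0ℚ → powerSum x (suc n) ≡ powerSum y (suc n)
  sufficient Σx≡0 = x∙y⁻¹≈ε⇒x≈y (powerSum x (suc n)) (powerSum y (suc n))
    (trans gap (trans (cong (λ s → - (scale * s)) Σx≡0) (cong -_ (*-zeroʳ scale))))

  necessary : powerSum x (suc n) ≡ powerSum y (suc n) → sumℚ x ≡ 0ℚ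
  necessary ps≡ = p*q≡0⇒q≡0 scale (sumℚ x) scale≢0
    (neg-injective (trans (sym gap) (x≈y⇒x∙y⁻¹≈ε ps≡)))
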